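{- Let $\lambda$ be a nonzero real number, $r\geq 0$ an integer and $z\in\mathbb{C}$. Then for every integer $n\geq0$, $$\phi_{n+1,\lambda}^{(r)}(|z|^2)=\sum_{k=0}^n\binom{n}{k}\phi_{k,\lambda}^{(r)}(|z|^2)\Big(|z|^2(1-\lambda)_{n-k,\lambda}+r(-\lambda)_{n-k,\lambda}\Big).$$
   Context: Degenerate falling factorials: $(x)_{0,\lambda}=1$, $(x)_{k,\lambda}=x(x-\lambda)\cdots(x-(k-1)\lambda)$ for $k\ge1$; ordinary falling factorials $(x)_0=1$, $(x)_k=x(x-1)\cdots(x-k+1)$. Degenerate $r$-Stirling numbers of the second kind are defined by $(x+r)_{n,\lambda}=\sum_{k=0}^n \begin{Bmatrix}n+r \\ k+r \end{Bmatrix}_{r,\lambda}(x)_k$ ($n\ge0$), and the degenerate $r$-Bell polynomials by $\phi_{n,\lambda}^{(r)}(x)=\sum_{k=0}^n \begin{Bmatrix}n+r \\ k+r \end{Bmatrix}_{r,\lambda}x^k$; equivalently $e_\lambda^r(t)e^{x(e_\lambda(t)-1)}=\sum_{n\ge0}\phi_{n,\lambda}^{(r)}(x)\frac{t^n}{n!}$, where $e_\lambda^x(t)=(1+\lambda t)^{x/\lambda}=\sum_{k\ge0}(x)_{k,\lambda}\frac{t^k}{k!}$ and $e_\lambda(t)=e_\lambda^1(t)$. -}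

module Defs where

open import Level using (Level; _⊔_)
open import Data.Nat as ℕ using (ℕ; zero; suc; _∸_)
open import Data.Nat.Combinatorics using (_C_)
open import Data.Product using (Σ-syntax)
open import Relation.Nullary using (¬_)
open import Algebra.Bundles using (CommutativeRing)

-- Everything is parametrised by a commutative ring R (stand-in for ℝ).
module _ {c ℓ : Level} (R : CommutativeRing c ℓ) where
  open CommutativeRing R

  fromℕ : ℕ → Carrier
  fromℕ zero    = 0#
  fromℕ (suc n) = 1# + fromℕ n

  pow : Carrier → ℕ → Carrier
  pow x zero    = 1#
  pow x (suc k) = pow x k * x

  sumTo : ℕ → (ℕ → Carrier) → Carrier
  sumTo zero    f = f 0
  sumTo (suc n) f = sumTo n f + f (suc n)

  degFall : Carrier → Carrier → ℕ → Carrier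
  degFall lam x zero    = 1#
  degFall lam x (suc k) = degFall lam x k * (x - fromℕ k * lam)

  fall : Carrier → ℕ → Carrier
  fall x k = degFall 1# x k

  IsFieldR : Set (c ⊔ ℓ)
  IsFieldR = ∀ x → ¬ (x ≈ 0#) → Σ[ y ∈ Carrier ] (x * y ≈ 1#)

  CharZero : Set ℓ
  CharZero = ∀ n → ¬ (fromℕ (suc n) ≈ 0#)

  -- S n k stands for the degenerate r-Stirling number {n+r, k+r}_{r,λ}; this is the
  -- paper's defining relation  (x+r)_{n,λ} = Σ_{k=0}^n {n+r,k+r}_{r,λ} (x)_k  for all x.
  IsDegRStirling : Carrier → ℕ → (ℕ → ℕ → Carrier) → Set (c ⊔ ℓ)
  IsDegRStirling lam r S =
    ∀ (n : ℕ) (x : Carrier) →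
      degFall lam (x + fromℕ r) n ≈ sumTo n (λ k → S n k * fall x k)

  degRBell : (ℕ → ℕ → Carrier) → ℕ → Carrier → Carrier
  degRBell S n x = sumTo n (λ k → S n k * pow x k)

{-# OPTIONS --safe #-}
-- Since (x + r)_{n+1,λ} = (x + r)(x + r − λ)_{n,λ}, writing x + r − λ once as
-- (x − 1 + r) + (1 − λ) and once as (x + r) + (−λ) and applying the Vandermonde
-- identity expands (x + r)_{n+1,λ} through the falling factorial expansions of
-- (x − 1 + r)_{k,λ} and (x + r)_{k,λ}.  Multiplying by x turns (x − 1)_j into (x)_{j+1},
-- exactly as multiplying by X turns X^j into X^{j+1}; so the coefficient sequence
-- this produces in the basis (x)_j yields the right-hand side in the basis X^j.
-- Over a field of characteristic zero the falling factorials are separated by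
-- evaluation at the natural numbers, hence that sequence is {n+1+r, j+r}_{r,λ}.
module Submission where

open import Defs
open import Level using (Level)
open import Data.Nat as ℕ using (ℕ; zero; suc; _∸_; _≤_; _<_; _≤′_; ≤′-refl; ≤′-step; z≤n; s≤s)
open import Data.Nat.Properties using (≤⇒≤′; ≤′⇒≤; m≤n⇒m≤1+n; ≤-refl; <⇒≱; +-∸-assoc)
open import Data.Nat.Combinatorics using (_C_; nCk+nC[k+1]≡[n+1]C[k+1]; k>n⇒nCk≡0)
open import Data.Product using (_,_)
open import Data.Maybe using (nothing)
open import Relation.Nullary using (¬_; yes; no; contradiction)
open import Relation.Binary.PropositionalEquality as ≡ using (_≡_)
open import Algebra.Bundles using (CommutativeRing)
import Algebra.Properties.Ring as RingProperties
import Algebra.Properties.CommutativeSemigroup as CommutativeSemigroupProperties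
import Algebra.Solver.Ring.NaturalCoefficients as NaturalCoefficientsSolver
import Relation.Binary.Reasoning.Setoid as SetoidReasoning

module _ {c ℓ : Level} (R : CommutativeRing c ℓ) where
  open CommutativeRing R
  open RingProperties ring using (-0#≈0#; -‿+-comm; +-cancelˡ)
  open CommutativeSemigroupProperties +-commutativeSemigroup using (interchange)
  open NaturalCoefficientsSolver commutativeSemiring (λ _ _ → nothing)
  open SetoidReasoning setoid

  sumTo-cong : ∀ N {f g : ℕ → Carrier} → (∀ k → k ≤ N → f k ≈ g k) → sumTo R N f ≈ sumTo R N g
  sumTo-cong zero    f≈g = f≈g 0 z≤n
  sumTo-cong (suc N) f≈g =
    +-cong (sumTo-cong N (λ k k≤N → f≈g k (m≤n⇒m≤1+n k≤N))) (f≈g (suc N) ≤-refl)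

  sumTo-+ : ∀ N (f g : ℕ → Carrier) → sumTo R N (λ k → f k + g k) ≈ sumTo R N f + sumTo R N g
  sumTo-+ zero    f g = refl
  sumTo-+ (suc N) f g = trans (+-cong (sumTo-+ N f g) refl) (interchange _ _ _ _)

  sumTo-*ˡ : ∀ N a (f : ℕ → Carrier) → sumTo R N (λ k → a * f k) ≈ a * sumTo R N f
  sumTo-*ˡ zero    a f = refl
  sumTo-*ˡ (suc N) a f = trans (+-cong (sumTo-*ˡ N a f) refl) (sym (distribˡ a _ _))

  sumTo-*ʳ : ∀ N a (f : ℕ → Carrier) → sumTo R N (λ k → f k * a) ≈ sumTo R N f * a
  sumTo-*ʳ N a f = begin
    sumTo R N (λ k → f k * a) ≈⟨ sumTo-cong N (λ k _ → *-comm (f k) a) ⟩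
    sumTo R N (λ k → a * f k) ≈⟨ sumTo-*ˡ N a f ⟩
    a * sumTo R N f           ≈⟨ *-comm a _ ⟩
    sumTo R N f * a           ∎

  sumTo-head : ∀ N (f : ℕ → Carrier) → sumTo R (suc N) f ≈ f 0 + sumTo R N (λ k → f (suc k))
  sumTo-head zero    f = refl
  sumTo-head (suc N) f = trans (+-cong (sumTo-head N f) refl) (+-assoc _ _ _)

  sumTo-comm : ∀ N M (G : ℕ → ℕ → Carrier) →
    sumTo R N (λ j → sumTo R M (G j)) ≈ sumTo R M (λ k → sumTo R N (λ j → G j k))
  sumTo-comm zero    M G = refl
  sumTo-comm (suc N) M G =
    trans (+-cong (sumTo-comm N M G) refl) (sym (sumTo-+ M (λ k → sumTo R N (λ j → G j k)) (G (suc N))))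

  sumTo-vanishing-tail : ∀ {k N} (f : ℕ → Carrier) → (∀ j → k < j → f j ≈ 0#) →
    k ≤′ N → sumTo R N f ≈ sumTo R k f
  sumTo-vanishing-tail f f≈0 ≤′-refl = refl
  sumTo-vanishing-tail {k} f f≈0 (≤′-step {N} k≤′N) = begin
    sumTo R N f + f (suc N) ≈⟨ +-cong (sumTo-vanishing-tail f f≈0 k≤′N) (f≈0 (suc N) (s≤s (≤′⇒≤ k≤′N))) ⟩
    sumTo R k f + 0#        ≈⟨ +-identityʳ _ ⟩
    sumTo R k f             ∎

  fromℕ-+ : ∀ m n → fromℕ R (m ℕ.+ n) ≈ fromℕ R m + fromℕ R n
  fromℕ-+ zero    n = sym (+-identityˡ _)
  fromℕ-+ (suc m) n = trans (+-cong refl (fromℕ-+ m n)) (sym (+-assoc _ _ _))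

  fromℕ-suc-1 : ∀ m → fromℕ R (suc m) - 1# ≈ fromℕ R m
  fromℕ-suc-1 m = begin
    (1# + fromℕ R m) - 1# ≈⟨ +-cong (+-comm 1# _) refl ⟩
    (fromℕ R m + 1#) - 1# ≈⟨ +-assoc _ _ _ ⟩
    fromℕ R m + (1# - 1#) ≈⟨ +-cong refl (-‿inverseʳ 1#) ⟩
    fromℕ R m + 0#        ≈⟨ +-identityʳ _ ⟩
    fromℕ R m             ∎

  *-cancelˡ-invertible : ∀ {u v a b} → u * v ≈ 1# → u * a ≈ u * b → a ≈ b
  *-cancelˡ-invertible {u} {v} {a} {b} uv≈1 ua≈ub = begin
    a             ≈⟨ reassociate a ⟩
    v * (u * a)   ≈⟨ *-cong refl ua≈ub ⟩
    v * (u * b)   ≈⟨ reassociate b ⟨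
    b             ∎
    where
    reassociate : ∀ x → x ≈ v * (u * x)
    reassociate x = begin
      x             ≈⟨ *-identityˡ x ⟨
      1# * x        ≈⟨ *-cong uv≈1 refl ⟨
      (u * v) * x   ≈⟨ solve 3 (λ u v x → (u :* v) :* x := v :* (u :* x)) refl u v x ⟩
      v * (u * x)   ∎

  degFall-cong : ∀ l k {x y} → x ≈ y → degFall R l x k ≈ degFall R l y k
  degFall-cong l zero    x≈y = refl
  degFall-cong l (suc k) x≈y = *-cong (degFall-cong l k x≈y) (+-cong x≈y refl)

  degFall-suc : ∀ l x k → degFall R l x (suc k) ≈ x * degFall R l (x - l) k
  degFall-suc l x zero = begin
    1# * (x - 0# * l) ≈⟨ *-identityˡ _ ⟩
    x - 0# * l        ≈⟨ +-cong refl (trans (-‿cong (zeroˡ l)) -0#≈0#) ⟩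
    x + 0#            ≈⟨ +-identityʳ x ⟩
    x                 ≈⟨ *-identityʳ x ⟨
    x * 1#            ∎
  degFall-suc l x (suc k) = begin
    degFall R l x (suc k) * (x - (1# + m) * l)
      ≈⟨ *-cong (degFall-suc l x k) shifted-factor ⟩
    (x * degFall R l (x - l) k) * ((x - l) - m * l)
      ≈⟨ *-assoc _ _ _ ⟩
    x * degFall R l (x - l) (suc k) ∎
    where
    m = fromℕ R k
    shifted-factor : x - (1# + m) * l ≈ (x - l) - m * l
    shifted-factor = begin
      x - (1# + m) * l      ≈⟨ +-cong refl (-‿cong (trans (distribʳ l 1# m) (+-cong (*-identityˡ l) refl))) ⟩
      x - (l + m * l)       ≈⟨ +-cong refl (-‿+-comm l (m * l)) ⟨
      x + (- l - m * l)     ≈⟨ +-assoc _ _ _ ⟨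
      (x - l) - m * l       ∎

  binomConv : ℕ → (ℕ → Carrier) → (ℕ → Carrier) → Carrier
  binomConv n f g = sumTo R n (λ k → fromℕ R (n C k) * f k * g (n ∸ k))

  binomConv-cong : ∀ n {f f′ g g′ : ℕ → Carrier} → (∀ k → f k ≈ f′ k) → (∀ k → g k ≈ g′ k) →
    binomConv n f g ≈ binomConv n f′ g′
  binomConv-cong n f≈f′ g≈g′ = sumTo-cong n (λ k _ → *-cong (*-cong refl (f≈f′ k)) (g≈g′ (n ∸ k)))

  binomConv-*ˡ : ∀ n a (f g : ℕ → Carrier) → binomConv n (λ k → a * f k) g ≈ a * binomConv n f g
  binomConv-*ˡ n a f g = trans
    (sumTo-cong n (λ k _ → solve 4 (λ C a f g → C :* (a :* f) :* g := a :* (C :* f :* g)) refl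
      (fromℕ R (n C k)) a (f k) (g (n ∸ k))))
    (sumTo-*ˡ n a _)

  binomConv-linearʳ : ∀ n y z (f g h : ℕ → Carrier) →
    binomConv n f (λ i → y * g i + z * h i) ≈ y * binomConv n f g + z * binomConv n f h
  binomConv-linearʳ n y z f g h = begin
    binomConv n f (λ i → y * g i + z * h i)
      ≈⟨ sumTo-cong n (λ k _ → solve 6 (λ C f y g z h → C :* f :* (y :* g :+ z :* h)
                                          := y :* (C :* f :* g) :+ z :* (C :* f :* h)) refl
                                  (fromℕ R (n C k)) (f k) y (g (n ∸ k)) z (h (n ∸ k))) ⟩
    sumTo R n (λ k → y * term g k + z * term h k)
      ≈⟨ sumTo-+ n _ _ ⟩
    sumTo R n (λ k → y * term g k) + sumTo R n (λ k → z * term h k)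
      ≈⟨ +-cong (sumTo-*ˡ n y _) (sumTo-*ˡ n z _) ⟩
    y * binomConv n f g + z * binomConv n f h ∎
    where
    term : (ℕ → Carrier) → ℕ → Carrier
    term g k = fromℕ R (n C k) * f k * g (n ∸ k)

  binomConv-*ʳ : ∀ n a (f g : ℕ → Carrier) → binomConv n f (λ i → a * g i) ≈ a * binomConv n f g
  binomConv-*ʳ n a f g = trans
    (sumTo-cong n (λ k _ → solve 4 (λ C f a g → C :* f :* (a :* g) := a :* (C :* f :* g)) refl
      (fromℕ R (n C k)) (f k) a (g (n ∸ k))))
    (sumTo-*ˡ n a _)

  -- Pascal's rule C(n+1,k+1) = C(n,k) + C(n,k+1), summed against f and g.
  binomConv-suc : ∀ n (f g : ℕ → Carrier) →
    binomConv (suc n) f g ≈ binomConv n (λ k → f (suc k)) g + binomConv n f (λ i → g (suc i))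
  binomConv-suc n f g = begin
    binomConv (suc n) f g
      ≈⟨ sumTo-head n _ ⟩
    lower 0 + sumTo R n (λ k → lower (suc k))
      ≈⟨ +-cong refl (trans (sumTo-cong n (λ k _ → pascal k)) (sumTo-+ n _ _)) ⟩
    lower 0 + (binomConv n (λ k → f (suc k)) g + sumTo R n (λ k → upper (suc k)))
      ≈⟨ solve 3 (λ x y z → x :+ (y :+ z) := y :+ (x :+ z)) refl _ _ _ ⟩
    binomConv n (λ k → f (suc k)) g + (upper 0 + sumTo R n (λ k → upper (suc k)))
      ≈⟨ +-cong refl (sumTo-head n upper) ⟨
    binomConv n (λ k → f (suc k)) g + sumTo R (suc n) upper
      ≈⟨ +-cong refl upper-sum ⟩
    binomConv n (λ k → f (suc k)) g + binomConv n f (λ i → g (suc i)) ∎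
    where
    lower upper : ℕ → Carrier
    lower k = fromℕ R (suc n C k) * f k * g (suc n ∸ k)
    upper k = fromℕ R (n C k) * f k * g (suc n ∸ k)
    pascal : ∀ k → lower (suc k) ≈ fromℕ R (n C k) * f (suc k) * g (n ∸ k) + upper (suc k)
    pascal k = begin
      fromℕ R (suc n C suc k) * f (suc k) * g (n ∸ k)
        ≡⟨ ≡.cong (λ t → fromℕ R t * f (suc k) * g (n ∸ k)) (≡.sym (nCk+nC[k+1]≡[n+1]C[k+1] n k)) ⟩
      fromℕ R (n C k ℕ.+ n C suc k) * f (suc k) * g (n ∸ k)
        ≈⟨ *-cong (*-cong (fromℕ-+ (n C k) (n C suc k)) refl) refl ⟩
      (fromℕ R (n C k) + fromℕ R (n C suc k)) * f (suc k) * g (n ∸ k)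
        ≈⟨ solve 4 (λ x y u v → (x :+ y) :* u :* v := x :* u :* v :+ y :* u :* v) refl _ _ _ _ ⟩
      fromℕ R (n C k) * f (suc k) * g (n ∸ k) + upper (suc k) ∎
    upper-sum : sumTo R (suc n) upper ≈ binomConv n f (λ i → g (suc i))
    upper-sum = begin
      sumTo R n upper + upper (suc n)
        ≈⟨ +-cong refl (*-cong (trans (*-cong (≡.subst (λ t → fromℕ R t ≈ 0#)
             (≡.sym (k>n⇒nCk≡0 {n} ≤-refl)) refl) refl) (zeroˡ _)) refl) ⟩
      sumTo R n upper + 0# * g (n ∸ n)
        ≈⟨ trans (+-cong refl (zeroˡ _)) (+-identityʳ _) ⟩
      sumTo R n upper
        ≈⟨ sumTo-cong n (λ k k≤n → ≡.subst (λ t → upper k ≈ fromℕ R (n C k) * f k * g t)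
             (+-∸-assoc 1 k≤n) refl) ⟩
      binomConv n f (λ i → g (suc i)) ∎

  degFall-vandermonde : ∀ l n a b →
    binomConv n (degFall R l a) (degFall R l b) ≈ degFall R l (a + b) n
  degFall-vandermonde l zero a b =
    trans (*-identityʳ _) (trans (*-identityʳ _) (+-identityʳ _))
  degFall-vandermonde l (suc n) a b = begin
    binomConv (suc n) (D a) (D b)
      ≈⟨ binomConv-suc n (D a) (D b) ⟩
    binomConv n (λ k → D a (suc k)) (D b) + binomConv n (D a) (λ i → D b (suc i))
      ≈⟨ +-cong (binomConv-cong n {f = λ k → D a (suc k)} {g = D b} (degFall-suc l a) (λ _ → refl))
                (binomConv-cong n {f = D a} {g = λ i → D b (suc i)} (λ _ → refl) (degFall-suc l b)) ⟩
    binomConv n (λ k → a * D (a - l) k) (D b) + binomConv n (D a) (λ i → b * D (b - l) i)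
      ≈⟨ +-cong (binomConv-*ˡ n a (D (a - l)) (D b)) (binomConv-*ʳ n b (D a) (D (b - l))) ⟩
    a * binomConv n (D (a - l)) (D b) + b * binomConv n (D a) (D (b - l))
      ≈⟨ +-cong (*-cong refl (degFall-vandermonde l n (a - l) b))
                (*-cong refl (degFall-vandermonde l n a (b - l))) ⟩
    a * D ((a - l) + b) n + b * D (a + (b - l)) n
      ≈⟨ +-cong (*-cong refl (degFall-cong l n (trans (+-assoc a _ b)
                  (trans (+-cong refl (+-comm _ b)) (sym (+-assoc a b _))))))
                (*-cong refl (degFall-cong l n (sym (+-assoc a b _)))) ⟩
    a * D ((a + b) - l) n + b * D ((a + b) - l) n
      ≈⟨ distribʳ _ a b ⟨
    (a + b) * D ((a + b) - l) n
      ≈⟨ degFall-suc l (a + b) n ⟨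
    D (a + b) (suc n) ∎
    where
    D = degFall R l

  lincomb : (ℕ → Carrier) → ℕ → (ℕ → Carrier) → Carrier
  lincomb g N c = sumTo R N (λ j → c j * g j)

  shift : (ℕ → Carrier) → ℕ → Carrier
  shift c zero    = 0#
  shift c (suc j) = c j

  truncate : ℕ → (ℕ → Carrier) → ℕ → Carrier
  truncate k c j with j ℕ.≤? k
  ... | yes _ = c j
  ... | no  _ = 0#

  truncate-≤ : ∀ {j k} c → j ≤ k → truncate k c j ≈ c j
  truncate-≤ {j} {k} c j≤k with j ℕ.≤? k
  ... | yes _   = refl
  ... | no  j≰k = contradiction j≤k j≰k

  truncate-> : ∀ {j k} c → k < j → truncate k c j ≈ 0#
  truncate-> {j} {k} c k<j with j ℕ.≤? k
  ... | yes j≤k = contradiction j≤k (<⇒≱ k<j)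
  ... | no  _   = refl

  lincomb-truncate : ∀ g {k N} c → k ≤ N → lincomb g N (truncate k c) ≈ lincomb g k c
  lincomb-truncate g {k} {N} c k≤N = begin
    lincomb g N (truncate k c)
      ≈⟨ sumTo-vanishing-tail _ (λ j k<j → trans (*-cong (truncate-> c k<j) refl) (zeroˡ _)) (≤⇒≤′ k≤N) ⟩
    lincomb g k (truncate k c)
      ≈⟨ sumTo-cong k (λ j j≤k → *-cong (truncate-≤ c j≤k) refl) ⟩
    lincomb g k c ∎

  lincomb-head : ∀ N {g h : ℕ → Carrier} {y} c → (∀ j → g (suc j) ≈ y * h j) →
    lincomb g (suc N) c ≈ c 0 * g 0 + y * lincomb h N (λ j → c (suc j))
  lincomb-head N {g} {h} {y} c g≈yh = begin
    lincomb g (suc N) c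
      ≈⟨ sumTo-head N _ ⟩
    c 0 * g 0 + sumTo R N (λ j → c (suc j) * g (suc j))
      ≈⟨ +-cong refl (sumTo-cong N (λ j _ → trans (*-cong refl (g≈yh j))
           (solve 3 (λ c y h → c :* (y :* h) := y :* (c :* h)) refl (c (suc j)) y (h j)))) ⟩
    c 0 * g 0 + sumTo R N (λ j → y * (c (suc j) * h j))
      ≈⟨ +-cong refl (sumTo-*ˡ N y _) ⟩
    c 0 * g 0 + y * lincomb h N (λ j → c (suc j)) ∎

  lincomb-shift : ∀ N {g h : ℕ → Carrier} {y} c → (∀ j → g (suc j) ≈ y * h j) →
    lincomb g (suc N) (shift c) ≈ y * lincomb h N c
  lincomb-shift N c g≈yh =
    trans (lincomb-head N (shift c) g≈yh) (trans (+-cong (zeroˡ _) refl) (+-identityˡ _))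

  lincomb-sumTo : ∀ g N n (w : ℕ → ℕ → Carrier) →
    lincomb g N (λ j → sumTo R n (λ k → w k j)) ≈ sumTo R n (λ k → lincomb g N (w k))
  lincomb-sumTo g N n w = trans (sumTo-cong N (λ j _ → sym (sumTo-*ʳ n (g j) _))) (sumTo-comm N n _)

  lincomb-linear : ∀ g N a b (u v : ℕ → Carrier) →
    lincomb g N (λ j → a * u j + b * v j) ≈ a * lincomb g N u + b * lincomb g N v
  lincomb-linear g N a b u v = begin
    lincomb g N (λ j → a * u j + b * v j)
      ≈⟨ sumTo-cong N (λ j _ → distribʳ (g j) _ _) ⟩
    sumTo R N (λ j → (a * u j) * g j + (b * v j) * g j)
      ≈⟨ sumTo-+ N _ _ ⟩
    sumTo R N (λ j → (a * u j) * g j) + sumTo R N (λ j → (b * v j) * g j)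
      ≈⟨ +-cong (trans (sumTo-cong N (λ j _ → *-assoc a _ _)) (sumTo-*ˡ N a _))
                (trans (sumTo-cong N (λ j _ → *-assoc b _ _)) (sumTo-*ˡ N b _)) ⟩
    a * lincomb g N u + b * lincomb g N v ∎

  -- Evaluating at x = 0 gives c_0; at x = m + 1 the remaining sum is (m + 1) Σ_j c_{j+1} (m)_j,
  -- and m + 1 is invertible.
  lincomb-fall-injective : IsFieldR R → CharZero R → ∀ N (c d : ℕ → Carrier) →
    (∀ m → lincomb (fall R (fromℕ R m)) N c ≈ lincomb (fall R (fromℕ R m)) N d) →
    ∀ j → j ≤ N → c j ≈ d j
  lincomb-fall-injective isField charZero zero c d c≈d .0 z≤n =
    trans (sym (*-identityʳ _)) (trans (c≈d 0) (*-identityʳ _))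
  lincomb-fall-injective isField charZero (suc N) c d c≈d = coefficients
    where
    at-zero : ∀ e → lincomb (fall R 0#) (suc N) e ≈ e 0 * 1#
    at-zero e = begin
      lincomb (fall R 0#) (suc N) e
        ≈⟨ lincomb-head N e (degFall-suc 1# 0#) ⟩
      e 0 * 1# + 0# * lincomb (fall R (0# - 1#)) N (λ j → e (suc j))
        ≈⟨ trans (+-cong refl (zeroˡ _)) (+-identityʳ _) ⟩
      e 0 * 1# ∎
    head≈ : c 0 * 1# ≈ d 0 * 1#
    head≈ = trans (sym (at-zero c)) (trans (c≈d 0) (at-zero d))
    fall-suc : ∀ m j → fall R (fromℕ R (suc m)) (suc j) ≈ fromℕ R (suc m) * fall R (fromℕ R m) j
    fall-suc m j = trans (degFall-suc 1# _ j) (*-cong refl (degFall-cong 1# j (fromℕ-suc-1 m)))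
    tail≈ : ∀ m → lincomb (fall R (fromℕ R m)) N (λ j → c (suc j))
                  ≈ lincomb (fall R (fromℕ R m)) N (λ j → d (suc j))
    tail≈ m with isField (fromℕ R (suc m)) (charZero m)
    ... | _ , invertible = *-cancelˡ-invertible invertible (+-cancelˡ _ _ _ (begin
      c 0 * 1# + _ ≈⟨ lincomb-head N c (fall-suc m) ⟨
      lincomb (fall R (fromℕ R (suc m))) (suc N) c ≈⟨ c≈d (suc m) ⟩
      lincomb (fall R (fromℕ R (suc m))) (suc N) d ≈⟨ lincomb-head N d (fall-suc m) ⟩
      d 0 * 1# + _ ≈⟨ +-cong head≈ refl ⟨
      c 0 * 1# + _ ∎))
    coefficients : ∀ j → j ≤ suc N → c j ≈ d j
    coefficients zero    _         = trans (sym (*-identityʳ _)) (trans head≈ (*-identityʳ _))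
    coefficients (suc j) (s≤s j≤N) =
      lincomb-fall-injective isField charZero N (λ j → c (suc j)) (λ j → d (suc j)) tail≈ j j≤N

  -- The coefficients of  y Σ_k C(n,k) α_{n−k} P_k + ρ Σ_k C(n,k) β_{n−k} Q_k  where P_k, Q_k
  -- have coefficients S k: shift accounts for the factor y, and truncate discards the values
  -- S k j with j > k, on which nothing is assumed.
  recurrenceCoeff : Carrier → (ℕ → Carrier) → (ℕ → Carrier) → (ℕ → ℕ → Carrier) → ℕ → ℕ → Carrier
  recurrenceCoeff ρ α β S n j = sumTo R n (λ k →
    fromℕ R (n C k) * α (n ∸ k) * truncate (suc k) (shift (S k)) j
      + fromℕ R (n C k) * ρ * β (n ∸ k) * truncate k (S k) j)

  lincomb-recurrenceCoeff : ∀ ρ α β S n {g h : ℕ → Carrier} {y} → (∀ j → g (suc j) ≈ y * h j) →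
    lincomb g (suc n) (recurrenceCoeff ρ α β S n)
      ≈ y * binomConv n (λ k → lincomb h k (S k)) α + ρ * binomConv n (λ k → lincomb g k (S k)) β
  lincomb-recurrenceCoeff ρ α β S n {g} {h} {y} g≈yh = begin
    lincomb g (suc n) (recurrenceCoeff ρ α β S n)
      ≈⟨ lincomb-sumTo g (suc n) n _ ⟩
    sumTo R n (λ k → lincomb g (suc n) (λ j → A k * truncate (suc k) (shift (S k)) j
                                             + B k * truncate k (S k) j))
      ≈⟨ sumTo-cong n (λ k _ → lincomb-linear g (suc n) (A k) (B k) _ _) ⟩
    sumTo R n (λ k → A k * lincomb g (suc n) (truncate (suc k) (shift (S k)))
                     + B k * lincomb g (suc n) (truncate k (S k)))
      ≈⟨ sumTo-cong n (λ k k≤n → +-cong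
           (*-cong refl (trans (lincomb-truncate g _ (s≤s k≤n)) (lincomb-shift k (S k) g≈yh)))
           (*-cong refl (lincomb-truncate g _ (m≤n⇒m≤1+n k≤n)))) ⟩
    sumTo R n (λ k → A k * (y * P k) + B k * Q k)
      ≈⟨ sumTo-cong n (λ k _ → solve 7 (λ C α y P ρ β Q →
           C :* α :* (y :* P) :+ C :* ρ :* β :* Q := y :* (C :* P :* α) :+ ρ :* (C :* Q :* β)) refl
           (fromℕ R (n C k)) (α (n ∸ k)) y (P k) ρ (β (n ∸ k)) (Q k)) ⟩
    sumTo R n (λ k → y * (fromℕ R (n C k) * P k * α (n ∸ k)) + ρ * (fromℕ R (n C k) * Q k * β (n ∸ k)))
      ≈⟨ trans (sumTo-+ n _ _) (+-cong (sumTo-*ˡ n y _) (sumTo-*ˡ n ρ _)) ⟩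
    y * binomConv n P α + ρ * binomConv n Q β ∎
    where
    A B P Q : ℕ → Carrier
    A k = fromℕ R (n C k) * α (n ∸ k)
    B k = fromℕ R (n C k) * ρ * β (n ∸ k)
    P k = lincomb h k (S k)
    Q k = lincomb g k (S k)

  module _ (lam : Carrier) (r : ℕ) (S : ℕ → ℕ → Carrier) (isStirling : IsDegRStirling R lam r S) where

    α β : ℕ → Carrier
    α = degFall R lam (1# - lam)
    β = degFall R lam (- lam)

    degFall-recurrence : ∀ n x → degFall R lam (x + fromℕ R r) (suc n)
      ≈ x * binomConv n (λ k → lincomb (fall R (x - 1#)) k (S k)) α
        + fromℕ R r * binomConv n (λ k → lincomb (fall R x) k (S k)) β
    degFall-recurrence n x = begin
      degFall R lam (x + ρ) (suc n)
        ≈⟨ degFall-suc lam (x + ρ) n ⟩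
      (x + ρ) * degFall R lam ((x + ρ) - lam) n
        ≈⟨ distribʳ _ x ρ ⟩
      x * degFall R lam ((x + ρ) - lam) n + ρ * degFall R lam ((x + ρ) - lam) n
        ≈⟨ +-cong (*-cong refl (degFall-cong lam n regroup)) refl ⟩
      x * degFall R lam (((x - 1#) + ρ) + (1# - lam)) n + ρ * degFall R lam ((x + ρ) + - lam) n
        ≈⟨ +-cong (*-cong refl (degFall-vandermonde lam n _ _))
                  (*-cong refl (degFall-vandermonde lam n _ _)) ⟨
      x * binomConv n (degFall R lam ((x - 1#) + ρ)) α + ρ * binomConv n (degFall R lam (x + ρ)) β
        ≈⟨ +-cong (*-cong refl (binomConv-cong n {f = degFall R lam ((x - 1#) + ρ)} {g = α}
                                 (λ k → isStirling k (x - 1#)) (λ _ → refl)))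
                  (*-cong refl (binomConv-cong n {f = degFall R lam (x + ρ)} {g = β}
                                 (λ k → isStirling k x) (λ _ → refl))) ⟩
      x * binomConv n (λ k → lincomb (fall R (x - 1#)) k (S k)) α
        + ρ * binomConv n (λ k → lincomb (fall R x) k (S k)) β ∎
      where
      ρ = fromℕ R r
      regroup : (x + ρ) - lam ≈ ((x - 1#) + ρ) + (1# - lam)
      regroup = begin
        (x + ρ) - lam                   ≈⟨ +-identityʳ _ ⟨
        ((x + ρ) - lam) + 0#            ≈⟨ +-cong refl (-‿inverseˡ 1#) ⟨
        ((x + ρ) - lam) + (- 1# + 1#)
          ≈⟨ solve 5 (λ x ρ nl n o → ((x :+ ρ) :+ nl) :+ (n :+ o) := ((x :+ n) :+ ρ) :+ (o :+ nl))
               refl x ρ (- lam) (- 1#) 1# ⟩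
        ((x - 1#) + ρ) + (1# - lam)     ∎

    degRBell-recurrence : IsFieldR R → CharZero R → ∀ n X →
      degRBell R S (suc n) X
        ≈ binomConv n (λ k → degRBell R S k X) (λ i → X * α i + fromℕ R r * β i)
    degRBell-recurrence isField charZero n X = begin
      lincomb (pow R X) (suc n) (S (suc n))
        ≈⟨ sumTo-cong (suc n) (λ j j≤n+1 → *-cong (same-coefficients j j≤n+1) refl) ⟩
      lincomb (pow R X) (suc n) coeff
        ≈⟨ lincomb-recurrenceCoeff ρ α β S n (λ j → *-comm (pow R X j) X) ⟩
      X * binomConv n (λ k → degRBell R S k X) α + ρ * binomConv n (λ k → degRBell R S k X) β
        ≈⟨ binomConv-linearʳ n X ρ _ α β ⟨
      binomConv n (λ k → degRBell R S k X) (λ i → X * α i + ρ * β i) ∎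
      where
      ρ = fromℕ R r
      coeff = recurrenceCoeff ρ α β S n
      same-coefficients : ∀ j → j ≤ suc n → S (suc n) j ≈ coeff j
      same-coefficients = lincomb-fall-injective isField charZero (suc n) (S (suc n)) coeff (λ m →
        let x = fromℕ R m in begin
        lincomb (fall R x) (suc n) (S (suc n)) ≈⟨ isStirling (suc n) x ⟨
        degFall R lam (x + ρ) (suc n)          ≈⟨ degFall-recurrence n x ⟩
        _                                      ≈⟨ lincomb-recurrenceCoeff ρ α β S n (degFall-suc 1# x) ⟨
        lincomb (fall R x) (suc n) coeff       ∎)

theorem6 : ∀ {c ℓ : Level} (R : CommutativeRing c ℓ) →
    let open CommutativeRing R in
    IsFieldR R → CharZero R →
    (lam : Carrier) → ¬ (lam ≈ 0#) →
    (r : ℕ) → (S : ℕ → ℕ → Carrier) → IsDegRStirling R lam r S →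
    (a b : Carrier) → (n : ℕ) →
    degRBell R S (suc n) (a * a + b * b)
    ≈ sumTo R n (λ k →
    fromℕ R (n C k) * degRBell R S k (a * a + b * b)
    * ((a * a + b * b) * degFall R lam (1# - lam) (n ∸ k)
    + fromℕ R r * degFall R lam (- lam) (n ∸ k)))
theorem6 R isField charZero lam _ r S isStirling a b n =
  degRBell-recurrence R lam r S isStirling isField charZero n (a * a + b * b)
  where open CommutativeRing R using (_+_; _*_)
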